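{- For every integer $n\ge 1$, $g(R_n)=\bar n$.
   Context: A decoration of a graph is a set of arrows on edges, at most one per edge; a vertex is a sink (source) if all its edges carry arrows into (out of) it; a state is a decoration with no sink or source at a vertex of degree $\ge2$. A follower of a state $X$ is a state $X\cup\{(v,w)\}$ with $\{v,w\}$ unmarked in $X$. Grundy value: $g(X)=\mathrm{mex}\{g(Y): Y \text{ a follower of } X\}$. $\bar n$ is $n\bmod 2$. For $n\ge1$, $R_n$ is the empty state of the path with vertices $0,1,\dots,n$. -}

module Defs where

open import Data.Nat using (ℕ; zero; suc; _+_; _≤ᵇ_; _≡ᵇ_)
open import Data.Bool using (Bool; true; false; _∧_; _∨_; not; if_then_else_)
open import Data.List using (List; []; _∷_; _++_; map; length; upTo; concatMap; filter; replicate)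
open import Data.Bool.ListAction using (all; any)
open import Data.Maybe using (Maybe; just; nothing)
open import Relation.Nullary.Decidable using (does)
open import Relation.Unary using (Decidable)
open import Data.Bool.Properties using (T?)

-- The path graph with vertices 0,1,…,n has edges e_i = {i, i+1} for i < n.
-- A decoration is a list of n marks, one per edge (the i-th mark is on e_i).
data Mark : Set where
  none : Mark
  toR  : Mark   -- arrow i → i+1
  toL  : Mark   -- arrow i+1 → i

-- How an incident edge looks from one of its endpoints.
data Side : Set where
  inS outS unm : Side

isIn : Side → Bool
isIn inS = true
isIn _   = false

isOut : Side → Bool
isOut outS = true
isOut _    = false

nth : {A : Set} → List A → ℕ → Maybe A
nth []       _       = nothing
nth (x ∷ xs) zero    = just x
nth (x ∷ xs) (suc k) = nth xs k

-- edge seen from its higher endpoint i+1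
fromHead : Mark → Side
fromHead none = unm
fromHead toR  = inS
fromHead toL  = outS

-- edge seen from its lower endpoint i
fromTail : Mark → Side
fromTail none = unm
fromTail toR  = outS
fromTail toL  = inS

incident : List Mark → ℕ → List Side
incident ms v = lower v ++ upper (nth ms v)
  where
  lower : ℕ → List Side
  lower zero    = []
  lower (suc u) with nth ms u
  ... | just m  = fromHead m ∷ []
  ... | nothing = []
  upper : Maybe Mark → List Side
  upper (just m) = fromTail m ∷ []
  upper nothing  = []

degree : List Mark → ℕ → ℕ
degree ms v = length (incident ms v)

isSink : List Mark → ℕ → Bool
isSink ms v = all isIn (incident ms v)

isSource : List Mark → ℕ → Bool
isSource ms v = all isOut (incident ms v)

vertices : List Mark → List ℕ
vertices ms = upTo (suc (length ms))

isState : List Mark → Bool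
isState ms = all (λ v → not (2 ≤ᵇ degree ms v) ∨ not (isSink ms v ∨ isSource ms v)) (vertices ms)

update : List Mark → ℕ → Mark → List Mark
update []       _       _ = []
update (x ∷ xs) zero    m = m ∷ xs
update (x ∷ xs) (suc k) m = x ∷ update xs k m

isNone : Maybe Mark → Bool
isNone (just none) = true
isNone _           = false

candidates : List Mark → List (List Mark)
candidates ms = concatMap
  (λ i → if isNone (nth ms i) then update ms i toR ∷ update ms i toL ∷ [] else [])
  (upTo (length ms))

followers : List Mark → List (List Mark)
followers ms = filter (λ Y → T? (isState Y)) (candidates ms)

unmarked : List Mark → ℕ
unmarked []          = 0
unmarked (none ∷ xs) = suc (unmarked xs)
unmarked (_ ∷ xs)    = unmarked xs

elem : ℕ → List ℕ → Bool
elem m = any (λ k → m ≡ᵇ k)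

mexFrom : ℕ → ℕ → List ℕ → ℕ
mexFrom m zero    l = m
mexFrom m (suc f) l = if elem m l then mexFrom (suc m) f l else m

mex : List ℕ → ℕ
mex l = mexFrom 0 (suc (length l)) l

-- Grundy value, by recursion on the number of unmarked edges
-- (every follower has exactly one fewer unmarked edge).
grundyAux : ℕ → List Mark → ℕ
grundyAux zero    X = mex []
grundyAux (suc k) X = mex (map (grundyAux k) (followers X))

grundy : List Mark → ℕ
grundy X = grundyAux (unmarked X) X

R : ℕ → List Mark
R n = replicate n none

-- Reflecting the path and reversing every arrow both map states to states, so their composite
-- is a symmetry of the game which keeps each mark and swaps the edges i and n − 1 − i.
-- In a symmetric state, a move off the middle edge can be answered by the same arrow on the
-- mirror edge: the two arrows never create a sink or source together, and the answer restores
-- symmetry. By induction, a symmetric state has Grundy value 1 if its middle edge exists and is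
-- free (taking it leads to a symmetric state without one) and 0 otherwise. R_n is symmetric and
-- has a free middle edge exactly when n is odd.
module Submission where

open import Defs
open import Data.Nat using (ℕ; _≤_; _%_)
open import Relation.Binary.PropositionalEquality using (_≡_)

open import Data.Bool using (Bool; true; false; T; not; _∨_; if_then_else_)
open import Data.Bool.Properties using (T?; T-≡)
open import Data.Empty using (⊥-elim)
open import Data.List using (List; []; _∷_; map; length; upTo)
open import Data.List.Membership.Propositional using (_∈_; _∉_)
open import Data.List.Membership.Propositional.Properties
  using (∈-upTo⁺; ∈-filter⁺; ∈-filter⁻; ∈-concatMap⁺; ∈-concatMap⁻; ∈-map⁺; ∈-map⁻)
open import Data.List.Properties using (map-cong-local; length-replicate)
open import Data.List.Relation.Unary.All as All using (All)
open import Data.List.Relation.Unary.All.Properties using (all⁺; all⁻)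
open import Data.List.Relation.Unary.Any as Any using (here; there)
open import Data.List.Relation.Unary.Any.Properties using (any⁺; any⁻)
open import Data.Maybe using (Maybe; just; nothing)
open import Data.Nat using (zero; suc; _+_; _<_; _≤ᵇ_; _≡ᵇ_; _≟_; _≤?_; _<?_; z≤n; s≤s; ⌊_/2⌋)
open import Data.Nat.Induction using (<-wellFounded)
open import Data.Nat.Properties
  using (≤-refl; ≤-trans; n≤1+n; ≰⇒>; ≮⇒≥; +-suc; +-comm; +-cancelˡ-≡; suc-injective;
         ≡ᵇ⇒≡; ≡⇒≡ᵇ; m≤m+n; n≡⌊n+n/2⌋; m≤n⇒∃[o]m+o≡n)
open import Data.Product using (∃-syntax; _×_; _,_; proj₁; proj₂)
open import Data.Sum using (_⊎_; inj₁; inj₂)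
open import Data.Unit using (tt)
open import Function using (_on_; Equivalence)
open import Induction.WellFounded using (WellFounded)
import Induction.WellFounded as WF
open import Level using (0ℓ)
open import Relation.Binary.Construct.On using (wellFounded)
open import Relation.Binary.PropositionalEquality
  using (refl; sym; trans; cong; subst; subst₂; _≢_; module ≡-Reasoning)
open import Relation.Nullary using (¬_; yes; no; contradiction)

-- Vertex u + 1 of the path is a sink or a source exactly when edges u and u + 1
-- carry opposite arrows (toR, toL) or (toL, toR).
admissible : Maybe Mark → Maybe Mark → Bool
admissible (just toR) (just toL) = false
admissible (just toL) (just toR) = false
admissible _          _          = true

AdmissibleAt : List Mark → ℕ → Set
AdmissibleAt X u = T (admissible (nth X u) (nth X (suc u)))

Admissible : List Mark → Set
Admissible X = ∀ u → AdmissibleAt X u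

admissible-nothingʳ : ∀ m → admissible m nothing ≡ true
admissible-nothingʳ nothing     = refl
admissible-nothingʳ (just none) = refl
admissible-nothingʳ (just toR)  = refl
admissible-nothingʳ (just toL)  = refl

admissible-comm : ∀ m m′ → admissible m m′ ≡ admissible m′ m
admissible-comm nothing     m′          = sym (admissible-nothingʳ m′)
admissible-comm m           nothing     = admissible-nothingʳ m
admissible-comm (just none) (just none) = refl
admissible-comm (just none) (just toR)  = refl
admissible-comm (just none) (just toL)  = refl
admissible-comm (just toR)  (just none) = refl
admissible-comm (just toR)  (just toR)  = refl
admissible-comm (just toR)  (just toL)  = refl
admissible-comm (just toL)  (just none) = refl
admissible-comm (just toL)  (just toR)  = refl
admissible-comm (just toL)  (just toL)  = refl

admissible-refl : ∀ m → T (admissible m m)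
admissible-refl nothing     = tt
admissible-refl (just none) = tt
admissible-refl (just toR)  = tt
admissible-refl (just toL)  = tt

vertexOk : List Mark → ℕ → Bool
vertexOk X v = not (2 ≤ᵇ degree X v) ∨ not (isSink X v ∨ isSource X v)

vertexOk-zero : ∀ X → T (vertexOk X 0)
vertexOk-zero X with nth X 0
... | just _  = tt
... | nothing = tt

vertexOk-suc : ∀ X u → vertexOk X (suc u) ≡ admissible (nth X u) (nth X (suc u))
vertexOk-suc X u with nth X u | nth X (suc u)
... | nothing   | nothing   = refl
... | nothing   | just _    = refl
... | just none | nothing   = refl
... | just toR  | nothing   = refl
... | just toL  | nothing   = refl
... | just none | just _    = refl
... | just toR  | just none = refl
... | just toR  | just toR  = refl
... | just toR  | just toL  = refl
... | just toL  | just none = refl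
... | just toL  | just toR  = refl
... | just toL  | just toL  = refl

nth-length : ∀ {A : Set} (X : List A) i {m} → nth X i ≡ just m → i < length X
nth-length (_ ∷ X) zero    _ = s≤s z≤n
nth-length (_ ∷ X) (suc i) e = s≤s (nth-length X i e)

nth-beyond : ∀ {A : Set} (X : List A) i → length X ≤ i → nth X i ≡ nothing
nth-beyond []      i       _       = refl
nth-beyond (_ ∷ X) (suc i) (s≤s h) = nth-beyond X i h

admissibleAt-beyond : ∀ X u → length X ≤ suc u → AdmissibleAt X u
admissibleAt-beyond X u n≤1+u =
  subst (λ m → T (admissible (nth X u) m)) (sym (nth-beyond X (suc u) n≤1+u))
        (subst T (sym (admissible-nothingʳ (nth X u))) tt)

isState⇒admissible : ∀ X → T (isState X) → Admissible X
isState⇒admissible X s u with suc u ≤? length X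
... | yes 1+u≤n = subst T (vertexOk-suc X u)
                    (All.lookup (all⁺ (vertexOk X) (vertices X) s) (∈-upTo⁺ (s≤s 1+u≤n)))
... | no 1+u≰n  with ≰⇒> 1+u≰n
... | s≤s n≤u = admissibleAt-beyond X u (≤-trans n≤u (n≤1+n u))

admissible⇒isState : ∀ X → Admissible X → T (isState X)
admissible⇒isState X adm = all⁻ (vertexOk X) {xs = vertices X} (All.tabulate λ {v} _ → ok v)
  where
  ok : ∀ v → T (vertexOk X v)
  ok zero    = vertexOk-zero X
  ok (suc u) = subst T (sym (vertexOk-suc X u)) (adm u)

length-update : ∀ (X : List Mark) i {d} → length (update X i d) ≡ length X
length-update []      _       = refl
length-update (_ ∷ X) zero    = refl
length-update (_ ∷ X) (suc i) = cong suc (length-update X i)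

nth-update-same : ∀ (X : List Mark) i {d} → i < length X → nth (update X i d) i ≡ just d
nth-update-same (_ ∷ X) zero    _       = refl
nth-update-same (_ ∷ X) (suc i) (s≤s h) = nth-update-same X i h

nth-update-other : ∀ (X : List Mark) {i a d} → i ≢ a → nth (update X i d) a ≡ nth X a
nth-update-other []      {_}     {_}     _   = refl
nth-update-other (_ ∷ X) {zero}  {zero}  i≢a = ⊥-elim (i≢a refl)
nth-update-other (_ ∷ X) {zero}  {suc a} _   = refl
nth-update-other (_ ∷ X) {suc i} {zero}  _   = refl
nth-update-other (_ ∷ X) {suc i} {suc a} i≢a = nth-update-other X (λ i≡a → i≢a (cong suc i≡a))

nth-update-pair : ∀ X {i j a d} → i ≢ j → i < length X → j < length X →
                  a ≡ i ⊎ a ≡ j → nth (update (update X i d) j d) a ≡ just d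
nth-update-pair X {i} i≢j i<n _ (inj₁ refl) =
  trans (nth-update-other (update X i _) λ j≡i → i≢j (sym j≡i)) (nth-update-same X i i<n)
nth-update-pair X {i} {j} _ _ j<n (inj₂ refl) =
  nth-update-same (update X i _) j (subst (j <_) (sym (length-update X i)) j<n)

update-comm : ∀ (X : List Mark) i j d → update (update X i d) j d ≡ update (update X j d) i d
update-comm []      _       _       _ = refl
update-comm (_ ∷ X) zero    zero    _ = refl
update-comm (_ ∷ X) zero    (suc j) _ = refl
update-comm (_ ∷ X) (suc i) zero    _ = refl
update-comm (x ∷ X) (suc i) (suc j) d = cong (x ∷_) (update-comm X i j d)

admissibleAt-update : ∀ X {j u d} → AdmissibleAt X u → u ≢ j → suc u ≢ j → AdmissibleAt (update X j d) u
admissibleAt-update X {j} {u} ok u≢j 1+u≢j =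
  subst₂ (λ m m′ → T (admissible m m′))
         (sym (nth-update-other X (λ j≡u → u≢j (sym j≡u))))
         (sym (nth-update-other X (λ j≡1+u → 1+u≢j (sym j≡1+u)))) ok

admissibleAt-equal : ∀ X {u} → nth X u ≡ nth X (suc u) → AdmissibleAt X u
admissibleAt-equal X {u} e = subst (λ r → T (admissible (nth X u) r)) e (admissible-refl (nth X u))

data IsArrow : Mark → Set where
  arrowR : IsArrow toR
  arrowL : IsArrow toL

arrow≢none : ∀ {d} → IsArrow d → just d ≢ just none
arrow≢none arrowR ()
arrow≢none arrowL ()

unmarked-update : ∀ X i {d} → nth X i ≡ just none → IsArrow d → unmarked X ≡ suc (unmarked (update X i d))
unmarked-update (none ∷ X) zero    _    arrowR = refl
unmarked-update (none ∷ X) zero    _    arrowL = refl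
unmarked-update (none ∷ X) (suc i) free a      = cong suc (unmarked-update X i free a)
unmarked-update (toR ∷ X)  (suc i) free a      = unmarked-update X i free a
unmarked-update (toL ∷ X)  (suc i) free a      = unmarked-update X i free a

unmarked-update-< : ∀ X i {d} → nth X i ≡ just none → IsArrow d → unmarked (update X i d) < unmarked X
unmarked-update-< X i free a = subst (suc (unmarked (update X i _)) ≤_) (sym (unmarked-update X i free a)) ≤-refl

data Move (X : List Mark) : List Mark → Set where
  move : ∀ {i d} → IsArrow d → nth X i ≡ just none → Admissible (update X i d) → Move X (update X i d)

movesAt : List Mark → ℕ → Maybe Mark → List (List Mark)
movesAt X i m = if isNone m then update X i toR ∷ update X i toL ∷ [] else []

follower-intro : ∀ {X Y} → Move X Y → Y ∈ followers X
follower-intro {X} (move {i} {d} a free adm) =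
  ∈-filter⁺ (λ Y → T? (isState Y)) candidate (admissible⇒isState (update X i d) adm)
  where
  atEdge : ∀ {e} → IsArrow e → update X i e ∈ movesAt X i (nth X i)
  atEdge arrowR rewrite free = here refl
  atEdge arrowL rewrite free = there (here refl)
  candidate : update X i d ∈ candidates X
  candidate = ∈-concatMap⁺ _ (Any.map (λ { refl → atEdge a }) (∈-upTo⁺ (nth-length X i free)))

follower-elim : ∀ {X Y} → Y ∈ followers X → Move X Y
follower-elim {X} {Y} Y∈ with ∈-filter⁻ (λ Y → T? (isState Y)) {xs = candidates X} Y∈
... | Y∈candidates , state with Any.satisfied (∈-concatMap⁻ _ {xs = upTo (length X)} Y∈candidates)
... | i , Y∈atEdge = atEdge (nth X i) refl Y∈atEdge
  where
  adm : Admissible Y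
  adm = isState⇒admissible Y state
  atEdge : ∀ m → nth X i ≡ m → Y ∈ movesAt X i m → Move X Y
  atEdge (just none) free (here refl)         = move arrowR free adm
  atEdge (just none) free (there (here refl)) = move arrowL free adm

unmarked-follower : ∀ {X Y} → Y ∈ followers X → unmarked X ≡ suc (unmarked Y)
unmarked-follower {X} Y∈ with follower-elim {X} Y∈
... | move {i} a free _ = unmarked-update X i free a

elem⇒∈ : ∀ {m} l → elem m l ≡ true → m ∈ l
elem⇒∈ {m} l e = Any.map (≡ᵇ⇒≡ m _) (any⁻ (m ≡ᵇ_) l (Equivalence.from T-≡ e))

∈⇒elem : ∀ {m l} → m ∈ l → elem m l ≡ true
∈⇒elem {m} m∈l = Equivalence.to T-≡ (any⁺ (m ≡ᵇ_) (Any.map (≡⇒≡ᵇ m _) m∈l))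

mexFrom-≥ : ∀ m f l → m ≤ mexFrom m f l
mexFrom-≥ m zero    l = ≤-refl
mexFrom-≥ m (suc f) l with elem m l
... | true  = ≤-trans (n≤1+n m) (mexFrom-≥ (suc m) f l)
... | false = ≤-refl

mex≡0 : ∀ l → 0 ∉ l → mex l ≡ 0
mex≡0 l 0∉l with elem 0 l in e
... | false = refl
... | true  = ⊥-elim (0∉l (elem⇒∈ l e))

mex≡1 : ∀ l → 0 ∈ l → 1 ∉ l → mex l ≡ 1
mex≡1 l@(_ ∷ _) 0∈l 1∉l rewrite ∈⇒elem 0∈l with elem 1 l in e
... | false = refl
... | true  = ⊥-elim (1∉l (elem⇒∈ l e))

mex≢0 : ∀ l → 0 ∈ l → mex l ≢ 0
mex≢0 l 0∈l rewrite ∈⇒elem 0∈l =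
  λ mex≡0 → contradiction (subst (1 ≤_) mex≡0 (mexFrom-≥ 1 (length l) l)) λ ()

mex≢1 : ∀ l → 1 ∈ l → mex l ≢ 1
mex≢1 l@(_ ∷ l′) 1∈l with elem 0 l
... | false = λ ()
... | true rewrite ∈⇒elem 1∈l =
  λ mex≡1 → contradiction (subst (2 ≤_) mex≡1 (mexFrom-≥ 2 (length l′) l)) λ { (s≤s ()) }

no-followers : ∀ X → unmarked X ≡ 0 → followers X ≡ []
no-followers X unmarked≡0 with followers X in fs
... | []    = refl
... | Y ∷ _ with () ← trans (sym unmarked≡0) (unmarked-follower {X} (subst (Y ∈_) (sym fs) (here refl)))

grundy-mex : ∀ X → grundy X ≡ mex (map grundy (followers X))
grundy-mex X with unmarked X in e
... | zero  rewrite no-followers X e = refl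
... | suc k = cong mex (map-cong-local {xs = followers X} (All.tabulate λ {Y} Y∈ →
                cong (λ m → grundyAux m Y) (suc-injective (trans (sym e) (unmarked-follower {X} Y∈)))))

grundy≡0 : ∀ X → (∀ {Y} → Y ∈ followers X → grundy Y ≢ 0) → grundy X ≡ 0
grundy≡0 X h = trans (grundy-mex X)
  (mex≡0 _ λ 0∈ → let _ , Y∈ , 0≡ = ∈-map⁻ grundy 0∈ in h Y∈ (sym 0≡))

grundy≡1 : ∀ X {Y} → Y ∈ followers X → grundy Y ≡ 0 →
           (∀ {Y} → Y ∈ followers X → grundy Y ≢ 1) → grundy X ≡ 1
grundy≡1 X Y∈ g≡0 h = trans (grundy-mex X)
  (mex≡1 _ (subst (_∈ _) g≡0 (∈-map⁺ grundy Y∈))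
           λ 1∈ → let _ , Y∈′ , 1≡ = ∈-map⁻ grundy 1∈ in h Y∈′ (sym 1≡))

grundy≢0 : ∀ X {Y} → Y ∈ followers X → grundy Y ≡ 0 → grundy X ≢ 0
grundy≢0 X Y∈ g≡0 = subst (_≢ 0) (sym (grundy-mex X)) (mex≢0 _ (subst (_∈ _) g≡0 (∈-map⁺ grundy Y∈)))

grundy≢1 : ∀ X {Y} → Y ∈ followers X → grundy Y ≡ 1 → grundy X ≢ 1
grundy≢1 X Y∈ g≡1 = subst (_≢ 1) (sym (grundy-mex X)) (mex≢1 _ (subst (_∈ _) g≡1 (∈-map⁺ grundy Y∈)))

record Mirror (n a b : ℕ) : Set where
  constructor mirror
  field
    1+a+b≡n : suc (a + b) ≡ n

mirror-sym : ∀ {n a b} → Mirror n a b → Mirror n b a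
mirror-sym {a = a} {b} (mirror e) = mirror (trans (cong suc (+-comm b a)) e)

mirror-unique : ∀ {n a b b′} → Mirror n a b → Mirror n a b′ → b ≡ b′
mirror-unique {a = a} (mirror e) (mirror e′) = +-cancelˡ-≡ a _ _ (suc-injective (trans e (sym e′)))

mirror-< : ∀ {n a b} → Mirror n a b → a < n
mirror-< {a = a} {b} (mirror refl) = s≤s (m≤m+n a b)

mirror-exists : ∀ {n a} → a < n → ∃[ b ] Mirror n a b
mirror-exists a<n = let b , e = m≤n⇒∃[o]m+o≡n a<n in b , mirror e

mirror-shift : ∀ {n a b} → Mirror n (suc a) b → Mirror n a (suc b)
mirror-shift {a = a} {b} (mirror e) = mirror (trans (cong suc (+-suc a b)) e)

mirror-length : ∀ {n n′ a b} → n ≡ n′ → Mirror n a b → Mirror n′ a b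
mirror-length refl m = m

middle-unique : ∀ {n c c′} → Mirror n c c → Mirror n c′ c′ → c ≡ c′
middle-unique {c = c} {c′} (mirror c↔c) (mirror c′↔c′) = begin
  c              ≡⟨ n≡⌊n+n/2⌋ c ⟩
  ⌊ c + c /2⌋    ≡⟨ cong ⌊_/2⌋ (suc-injective (trans c↔c (sym c′↔c′))) ⟩
  ⌊ c′ + c′ /2⌋  ≡⟨ sym (n≡⌊n+n/2⌋ c′) ⟩
  c′             ∎
  where open ≡-Reasoning

record Reflection (X X′ : List Mark) : Set where
  constructor reflection
  field
    sameLength : length X ≡ length X′
    reflect    : ∀ {a b} → Mirror (length X) a b → nth X a ≡ nth X′ b

Symmetric : List Mark → Set
Symmetric X = Reflection X X

reflection-update : ∀ {X X′ i j} d → Reflection X X′ → Mirror (length X) i j →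
                    Reflection (update X i d) (update X′ j d)
reflection-update {X} {X′} {i} {j} d (reflection len reflect) i↔j =
  reflection (trans (length-update X i) (trans len (sym (length-update X′ j)))) reflect′
  where
  reflect′ : ∀ {a b} → Mirror (length (update X i d)) a b → nth (update X i d) a ≡ nth (update X′ j d) b
  reflect′ {a} {b} a↔b′ with mirror-length (length-update X i) a↔b′
  ... | a↔b with a ≟ i
  ... | yes refl with refl ← mirror-unique a↔b i↔j =
    trans (nth-update-same X a (mirror-< a↔b))
          (sym (nth-update-same X′ j (subst (j <_) len (mirror-< (mirror-sym i↔j)))))
  ... | no a≢i = trans (nth-update-other X (λ i≡a → a≢i (sym i≡a)))
                   (trans (reflect a↔b) (sym (nth-update-other X′ j≢b)))
    where
    j≢b : j ≢ b
    j≢b refl = a≢i (mirror-unique (mirror-sym a↔b) (mirror-sym i↔j))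

admissibleAt-reflect : ∀ {X X′ u u′} → Reflection X X′ → Mirror (length X) (suc u) u′ →
                       AdmissibleAt X u′ → AdmissibleAt X′ u
admissibleAt-reflect {X} {X′} {u} {u′} (reflection _ reflect) m ok =
  subst₂ (λ l r → T (admissible l r)) (reflect (mirror-sym (mirror-shift m))) (reflect (mirror-sym m))
         (subst T (admissible-comm (nth X u′) (nth X (suc u′))) ok)

admissible-reflect : ∀ {X X′} → Reflection X X′ → Admissible X → Admissible X′
admissible-reflect {X} {X′} r adm u with suc u <? length X
... | yes 1+u<n = let u′ , m = mirror-exists 1+u<n in admissibleAt-reflect r m (adm u′)
... | no 1+u≮n  = admissibleAt-beyond X′ u (subst (_≤ suc u) (Reflection.sameLength r) (≮⇒≥ 1+u≮n))

admissible-update-pair : ∀ X {i j d} → i ≢ j → i < length X → j < length X →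
                         Admissible (update X i d) → Admissible (update X j d) →
                         Admissible (update (update X i d) j d)
admissible-update-pair X {i} {j} {d} i≢j i<n j<n admᵢ admⱼ u
  with u ≟ j | suc u ≟ j | u ≟ i | suc u ≟ i
... | yes u≡j | _         | yes u≡i | _         = ⊥-elim (i≢j (trans (sym u≡i) u≡j))
... | _       | yes 1+u≡j | _       | yes 1+u≡i = ⊥-elim (i≢j (trans (sym 1+u≡i) 1+u≡j))
... | no u≢j  | no 1+u≢j  | _       | _         = admissibleAt-update (update X i d) (admᵢ u) u≢j 1+u≢j
... | _       | _         | no u≢i  | no 1+u≢i  =
  subst (λ Z → AdmissibleAt Z u) (update-comm X j i d) (admissibleAt-update (update X j d) (admⱼ u) u≢i 1+u≢i)
... | yes u≡j | _         | _       | yes 1+u≡i = admissibleAt-equal (update (update X i d) j d)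
  (trans (nth-update-pair X i≢j i<n j<n (inj₂ u≡j)) (sym (nth-update-pair X i≢j i<n j<n (inj₁ 1+u≡i))))
... | _       | yes 1+u≡j | yes u≡i | _         = admissibleAt-equal (update (update X i d) j d)
  (trans (nth-update-pair X i≢j i<n j<n (inj₁ u≡i)) (sym (nth-update-pair X i≢j i<n j<n (inj₂ 1+u≡j))))

MiddleFree : List Mark → Set
MiddleFree X = ∃[ c ] Mirror (length X) c c × nth X c ≡ just none

record MirrorReply (X Y : List Mark) : Set where
  field
    reply           : List Mark
    reply∈followers : reply ∈ followers Y
    admissibleReply : Admissible reply
    symmetricReply  : Symmetric reply
    middleFree⇒     : MiddleFree X → MiddleFree reply
    middleFree⇐     : MiddleFree reply → MiddleFree X
    unmarked<       : unmarked reply < unmarked X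

mirrorReply : ∀ X {i j d} → Symmetric X → IsArrow d → nth X i ≡ just none → Admissible (update X i d) →
              Mirror (length X) i j → i ≢ j → MirrorReply X (update X i d)
mirrorReply X {i} {j} {d} symX a freeᵢ admᵢ i↔j i≢j = record
  { reply           = update Y j d
  ; reply∈followers = follower-intro (move a freeⱼ admissibleReply)
  ; admissibleReply = admissibleReply
  ; symmetricReply  = subst (Reflection (update Y j d)) (update-comm X j i d)
                        (reflection-update d (reflection-update d symX i↔j)
                                             (mirror-length (sym (length-update X i)) (mirror-sym i↔j)))
  ; middleFree⇒     = λ (c , c↔c , free) →
                        c , mirror-length (sym sameLength) c↔c , trans (unchanged c↔c) free
  ; middleFree⇐     = λ (c , c↔c , free) → let c↔c′ = mirror-length sameLength c↔c in
                        c , c↔c′ , trans (sym (unchanged c↔c′)) free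
  ; unmarked<       = ≤-trans (unmarked-update-< Y j freeⱼ a) (≤-trans (n≤1+n _) (unmarked-update-< X i freeᵢ a))
  }
  where
  Y : List Mark
  Y = update X i d
  i<n : i < length X
  i<n = mirror-< i↔j
  j<n : j < length X
  j<n = mirror-< (mirror-sym i↔j)
  freeⱼ : nth Y j ≡ just none
  freeⱼ = trans (nth-update-other X i≢j) (trans (sym (Reflection.reflect symX i↔j)) freeᵢ)
  admissibleReply : Admissible (update Y j d)
  admissibleReply = admissible-update-pair X i≢j i<n j<n admᵢ
                      (admissible-reflect (reflection-update d symX i↔j) admᵢ)
  sameLength : length (update Y j d) ≡ length X
  sameLength = trans (length-update Y j) (length-update X i)
  unchanged : ∀ {c} → Mirror (length X) c c → nth (update Y j d) c ≡ nth X c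
  unchanged c↔c = trans (nth-update-other Y j≢c) (nth-update-other X i≢c)
    where
    i≢c : i ≢ _
    i≢c refl = i≢j (mirror-unique c↔c i↔j)
    j≢c : j ≢ _
    j≢c refl = i≢j (mirror-unique (mirror-sym i↔j) c↔c)

towards : Maybe Mark → Mark
towards (just toL) = toL
towards _          = toR

towards-isArrow : ∀ m → IsArrow (towards m)
towards-isArrow nothing     = arrowR
towards-isArrow (just none) = arrowR
towards-isArrow (just toR)  = arrowR
towards-isArrow (just toL)  = arrowL

admissible-towards : ∀ m → T (admissible (just (towards m)) m)
admissible-towards nothing     = tt
admissible-towards (just none) = tt
admissible-towards (just toR)  = tt
admissible-towards (just toL)  = tt

-- The middle arrow is chosen compatible with the next edge; by symmetry it is then
-- compatible with the previous one too.
admissible-middleMove : ∀ X {c} → Admissible X → Symmetric X → Mirror (length X) c c → nth X c ≡ just none →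
                        Admissible (update X c (towards (nth X (suc c))))
admissible-middleMove X {c} admX symX c↔c free = admissibleZ
  where
  d : Mark
  d = towards (nth X (suc c))
  Z : List Mark
  Z = update X c d
  atMiddle : AdmissibleAt Z c
  atMiddle = subst₂ (λ l r → T (admissible l r))
               (sym (nth-update-same X c (mirror-< c↔c))) (sym (nth-update-other X λ ()))
               (admissible-towards (nth X (suc c)))
  admissibleZ : Admissible Z
  admissibleZ u with u ≟ c | suc u ≟ c
  ... | yes refl | _        = atMiddle
  ... | no _     | yes refl =
    admissibleAt-reflect (reflection-update d symX c↔c) (mirror-length (sym (length-update X c)) c↔c) atMiddle
  ... | no u≢c   | no 1+u≢c = admissibleAt-update X (admX u) u≢c 1+u≢c

middleTaken-update : ∀ X {c d} → Mirror (length X) c c → IsArrow d → ¬ MiddleFree (update X c d)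
middleTaken-update X {c} c↔c a (c′ , c′↔c′ , free)
  with refl ← middle-unique (mirror-length (length-update X c) c′↔c′) c↔c =
  arrow≢none a (trans (sym (nth-update-same X c (mirror-< c↔c))) free)

ValueByMiddle : List Mark → Set
ValueByMiddle X = (MiddleFree X → grundy X ≡ 1) × (¬ MiddleFree X → grundy X ≡ 0)

unmarked-wellFounded : WellFounded (_<_ on unmarked)
unmarked-wellFounded = wellFounded unmarked <-wellFounded

valueByMiddle : ∀ X → Admissible X → Symmetric X → ValueByMiddle X
valueByMiddle = WF.All.wfRec unmarked-wellFounded 0ℓ (λ X → Admissible X → Symmetric X → ValueByMiddle X) step
  where
  step : ∀ X → (∀ {Y} → unmarked Y < unmarked X → Admissible Y → Symmetric Y → ValueByMiddle Y) →
         Admissible X → Symmetric X → ValueByMiddle X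
  step X rec admX symX = middleFree , middleTaken
    where
    replyOffMiddle : ∀ {i d} → IsArrow d → nth X i ≡ just none → Admissible (update X i d) →
                     ¬ Mirror (length X) i i → MirrorReply X (update X i d)
    replyOffMiddle {i} a free adm i↮i with mirror-exists (nth-length X i free)
    ... | j , i↔j = mirrorReply X symX a free adm i↔j λ { refl → i↮i i↔j }

    valueOfReply : ∀ {Y} (r : MirrorReply X Y) → ValueByMiddle (MirrorReply.reply r)
    valueOfReply r = rec unmarked< admissibleReply symmetricReply
      where open MirrorReply r

    middleTaken : ¬ MiddleFree X → grundy X ≡ 0
    middleTaken taken = grundy≡0 X λ Y∈ → answer (follower-elim Y∈)
      where
      answer : ∀ {Y} → Move X Y → grundy Y ≢ 0
      answer (move {i} {d} a free adm) =
        let r = replyOffMiddle a free adm λ i↔i → taken (i , i↔i , free)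
            open MirrorReply r
        in grundy≢0 (update X i d) reply∈followers (proj₂ (valueOfReply r) λ f → taken (middleFree⇐ f))

    middleFree : MiddleFree X → grundy X ≡ 1
    middleFree (c , c↔c , free) =
      grundy≡1 X (follower-intro {X} (move {i = c} (towards-isArrow m) free admZ))
                 (valueOfMiddleMove (towards-isArrow m) admZ)
                 λ Y∈ → answer (follower-elim Y∈)
      where
      m : Maybe Mark
      m = nth X (suc c)
      admZ : Admissible (update X c (towards m))
      admZ = admissible-middleMove X admX symX c↔c free
      valueOfMiddleMove : ∀ {d} → IsArrow d → Admissible (update X c d) → grundy (update X c d) ≡ 0
      valueOfMiddleMove {d} a adm =
        proj₂ (rec (unmarked-update-< X c free a) adm (reflection-update d symX c↔c)) (middleTaken-update X c↔c a)
      answer : ∀ {Y} → Move X Y → grundy Y ≢ 1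
      answer (move {i} {d} a freeᵢ adm) with i ≟ c
      ... | yes refl = λ g≡1 → contradiction (trans (sym (valueOfMiddleMove a adm)) g≡1) λ ()
      ... | no i≢c =
        let r = replyOffMiddle a freeᵢ adm λ i↔i → i≢c (middle-unique i↔i c↔c)
            open MirrorReply r
        in grundy≢1 (update X i d) reply∈followers (proj₁ (valueOfReply r) (middleFree⇒ (c , c↔c , free)))

nth-R : ∀ n u → u < n → nth (R n) u ≡ just none
nth-R (suc n) zero    _       = refl
nth-R (suc n) (suc u) (s≤s h) = nth-R n u h

admissible-R : ∀ n → Admissible (R n)
admissible-R zero    u       = tt
admissible-R (suc n) zero    = tt
admissible-R (suc n) (suc u) = admissible-R n u

symmetric-R : ∀ n → Symmetric (R n)
symmetric-R n = reflection refl λ a↔b →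
  trans (nth-R n _ (inRange a↔b)) (sym (nth-R n _ (inRange (mirror-sym a↔b))))
  where
  inRange : ∀ {a b} → Mirror (length (R n)) a b → a < n
  inRange {a} a↔b = subst (a <_) (length-replicate n) (mirror-< a↔b)

[c+c]%2≡0 : ∀ c → (c + c) % 2 ≡ 0
[c+c]%2≡0 zero                      = refl
[c+c]%2≡0 (suc c) rewrite +-suc c c = [c+c]%2≡0 c

[1+c+c]%2≡1 : ∀ c → suc (c + c) % 2 ≡ 1
[1+c+c]%2≡1 zero                      = refl
[1+c+c]%2≡1 (suc c) rewrite +-suc c c = [1+c+c]%2≡1 c

odd≢even : ∀ a b → suc (a + a) ≢ b + b
odd≢even a b e = contradiction (trans (sym ([1+c+c]%2≡1 a)) (trans (cong (_% 2) e) ([c+c]%2≡0 b))) λ ()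

even-or-odd : ∀ n → (∃[ c ] n ≡ c + c) ⊎ (∃[ c ] n ≡ suc (c + c))
even-or-odd zero = inj₁ (0 , refl)
even-or-odd (suc n) with even-or-odd n
... | inj₁ (c , refl) = inj₂ (c , refl)
... | inj₂ (c , refl) = inj₁ (suc c , cong suc (sym (+-suc c c)))

middleFree-R : ∀ c → MiddleFree (R (suc (c + c)))
middleFree-R c = c , mirror (sym (length-replicate (suc (c + c)))) , nth-R (suc (c + c)) c (s≤s (m≤m+n c c))

middleTaken-R : ∀ c → ¬ MiddleFree (R (c + c))
middleTaken-R c (c′ , mirror e , _) = odd≢even c′ c (trans e (length-replicate (c + c)))

mainTheorem10 : (n : ℕ) → 1 ≤ n → grundy (R n) ≡ n % 2
mainTheorem10 n _ with even-or-odd n | valueByMiddle (R n) (admissible-R n) (symmetric-R n)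
... | inj₁ (c , refl) | _ , taken⇒0 = trans (taken⇒0 (middleTaken-R c)) (sym ([c+c]%2≡0 c))
... | inj₂ (c , refl) | free⇒1 , _  = trans (free⇒1 (middleFree-R c)) (sym ([1+c+c]%2≡1 c))
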